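{- Let $V$ be a finite set and let $\mathcal{A},\mathcal{B}\subseteq 2^V$ be two hypergraphs on $V$. (1) If $S\subseteq V$ is a bi-objective minimal transversal of $(\mathcal{A},\mathcal{B})$, then $\mathcal{B}_S$ is an inclusion-minimal subset $B\subseteq\mathcal{B}$ with $f(B)=1$. (2) If $B\subseteq\mathcal{B}$ is an inclusion-minimal subset with $f(B)=1$, then every minimal transversal $S$ of $\mathcal{A}$ with $S\subseteq S_B$ is a bi-objective minimal transversal of $(\mathcal{A},\mathcal{B})$, and $\mathcal{B}_S=B$.
   Context: A transversal of a hypergraph $\mathcal{A}$ on $V$ is a set $S\subseteq V$ meeting every hyperedge of $\mathcal{A}$. For $S\subseteq V$, $\mathcal{A}_S=\{A\in\mathcal{A}: S\cap A\neq\emptyset\}$ and $\mathcal{B}_S=\{B\in\mathcal{B}: S\cap B\neq\emptyset\}$; for $x\in V$, $\mathcal{B}_x=\mathcal{B}_{\{x\}}$ is the set of hyperedges of $\mathcal{B}$ containing $x$. A set $S\subseteq V$ is a bi-objective minimal transversal of $(\mathcal{A},\mathcal{B})$ if (i) $\mathcal{A}_S=\mathcal{A}$ and $S$ is inclusion-minimal with this property, and (ii) there is no $S'$ satisfying (i) with $\mathcal{B}_{S'}\subsetneq\mathcal{B}_S$. For $B\subseteq\mathcal{B}$, $S_B=\{x\in V:\mathcal{B}_x\subseteq B\}$, and $f(B)=1$ if $S_B$ is a transversal of $\mathcal{A}$, $f(B)=0$ otherwise. -}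

module Defs where

open import Data.Nat using (ℕ)
open import Data.Bool using (if_then_else_)
open import Data.Fin using (Fin)
open import Data.Fin.Subset using (Subset; Side; inside; outside; _∈_; _⊆_; _⊂_; Nonempty; _∩_)
open import Data.Fin.Subset.Properties using (nonempty?; _⊆?_; _∈?_)
open import Data.Vec using (tabulate)
open import Data.Product using (_×_)
open import Relation.Nullary using (¬_; Dec)
open import Relation.Nullary.Decidable using (⌊_⌋)
open import Function.Definitions using (Injective)
open import Relation.Binary.PropositionalEquality using (_≡_)

-- Ground set V = Fin n.  A hypergraph on V with m hyperedges is a family
-- Fin m → Subset n; it is a *set* of hyperedges when the family is injective.
-- A subset of the hyperedges is a Subset m of indices.
Hypergraph : ℕ → ℕ → Set
Hypergraph n m = Fin m → Subset n

IsSimple : ∀ {n m} → Hypergraph n m → Set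
IsSimple H = Injective _≡_ _≡_ H

⟦_⟧ : ∀ {m} {P : Fin m → Set} → (∀ i → Dec (P i)) → Subset m
⟦ d ⟧ = tabulate (λ i → if ⌊ d i ⌋ then inside else outside)

hit : ∀ {n m} → Hypergraph n m → Subset n → Subset m
hit H S = ⟦ (λ i → nonempty? (S ∩ H i)) ⟧

star : ∀ {n m} → Hypergraph n m → Fin n → Subset m
star H x = ⟦ (λ i → x ∈? H i) ⟧

Transversal : ∀ {n a} → Hypergraph n a → Subset n → Set
Transversal {a = a} A S = ∀ (i : Fin a) → Nonempty (S ∩ A i)

MinimalTransversal : ∀ {n a} → Hypergraph n a → Subset n → Set
MinimalTransversal A S =
  Transversal A S × (∀ S' → S' ⊂ S → ¬ Transversal A S')

BiObjMinTransversal : ∀ {n a b} → Hypergraph n a → Hypergraph n b → Subset n → Set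
BiObjMinTransversal A B S =
  MinimalTransversal A S ×
  (∀ S' → MinimalTransversal A S' → ¬ (hit B S' ⊂ hit B S))

S[_] : ∀ {n b} → Hypergraph n b → Subset b → Subset n
S[ B ] C = ⟦ (λ x → star B x ⊆? C) ⟧

-- f(C) = 1  iff  S_C is a transversal of 𝓐
f≡1 : ∀ {n a b} → Hypergraph n a → Hypergraph n b → Subset b → Set
f≡1 A B C = Transversal A (S[ B ] C)

MinimalF : ∀ {n a b} → Hypergraph n a → Hypergraph n b → Subset b → Set
MinimalF A B C = f≡1 A B C × (∀ C' → C' ⊂ C → ¬ f≡1 A B C')

-- The maps S ↦ 𝓑_S and C ↦ S_C form a Galois connection, 𝓑_S ⊆ C ⇔ S ⊆ S_C.
-- Hence f(𝓑_S) = 1 for every transversal S, and every C with f(C) = 1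
-- contains 𝓑_S for some minimal transversal S ⊆ S_C (which exists since ⊂ is
-- well-founded on finite sets).  So a strictly smaller C′ ⊂ 𝓑_S with f(C′) = 1
-- would yield a minimal transversal S′ with 𝓑_S′ ⊂ 𝓑_S, and vice versa; this
-- exchange of minimal elements gives both parts.
module Submission where

open import Defs
open import Data.Fin.Subset using (Subset; _⊆_)
open import Data.Product using (_×_)
open import Relation.Binary.PropositionalEquality using (_≡_)

open import Level using (0ℓ)
open import Data.Nat using (ℕ)
open import Data.Nat.Induction using (<-wellFounded)
open import Data.Bool using (if_then_else_)
open import Data.Fin using (Fin)
open import Data.Fin.Subset using (inside; outside; _∈_; _⊂_; _∩_; ∣_∣)
open import Data.Fin.Subset.Properties
  using (nonempty?; _∈?_; _⊂?_; x∈p∩q⁺; x∈p∩q⁻; anySubset?;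
         p⊂q⇒∣p∣<∣q∣; ⊆-refl; ⊆-reflexive; ⊆-trans; ⊆-antisym; ⊆-⊂-trans; ⊂-⊆-trans)
open import Data.Fin.Properties using (all?)
open import Data.Vec.Properties using (lookup∘tabulate; []=⇒lookup; lookup⇒[]=)
open import Data.Product using (∃-syntax; _,_; proj₁)
open import Data.Empty using (⊥-elim)
open import Induction.WellFounded using (WellFounded; Acc; acc; module Subrelation)
open import Relation.Binary.Construct.On as On using ()
open import Relation.Nullary using (¬_; Dec; yes; no)
open import Relation.Nullary.Decidable using (⌊_⌋; _×-dec_)
open import Relation.Unary using (Pred; Decidable)
open import Relation.Binary.PropositionalEquality using (trans; sym; cong)

module _ {m} {P : Fin m → Set} (P? : ∀ i → Dec (P i)) where

  ∈⟦⟧⁺ : ∀ {i} → P i → i ∈ ⟦ P? ⟧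
  ∈⟦⟧⁺ {i} p with P? i in eq
  ... | yes _ = lookup⇒[]= i _ (trans (lookup∘tabulate _ i) (cong (λ d → if ⌊ d ⌋ then inside else outside) eq))
  ... | no ¬p = ⊥-elim (¬p p)

  ∈⟦⟧⁻ : ∀ {i} → i ∈ ⟦ P? ⟧ → P i
  ∈⟦⟧⁻ {i} i∈ with P? i | trans (sym (lookup∘tabulate _ i)) ([]=⇒lookup i∈)
  ... | yes p | _  = p
  ... | no _  | ()

module _ {n : ℕ} where

  ⊂-wellFounded : WellFounded (_⊂_ {n})
  ⊂-wellFounded = Subrelation.wellFounded p⊂q⇒∣p∣<∣q∣ (On.wellFounded ∣_∣ <-wellFounded)

  Minimal : Pred (Subset n) 0ℓ → Subset n → Set
  Minimal P S = P S × (∀ S′ → S′ ⊂ S → ¬ P S′)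

  module _ {P : Pred (Subset n) 0ℓ} (P? : Decidable P) where

    minimal-⊆ : ∀ {T} → P T → ∃[ S ] S ⊆ T × Minimal P S
    minimal-⊆ {T} = go T (⊂-wellFounded T)
      where
      go : ∀ T → Acc _⊂_ T → P T → ∃[ S ] S ⊆ T × Minimal P S
      go T (acc below) pT with anySubset? (λ S → S ⊂? T ×-dec P? S)
      ... | yes (S , S⊂T , pS) =
        let R , R⊆S , minR = go S (below S⊂T) pS in R , ⊆-trans R⊆S (proj₁ S⊂T) , minR
      ... | no ∄S = T , ⊆-refl , pT , λ S S⊂T pS → ∄S (S , S⊂T , pS)

  minimal-unique : ∀ {P C C′} → Minimal P C → C′ ⊆ C → P C′ → C′ ≡ C
  minimal-unique {C = C} {C′} (_ , noSmaller) C′⊆C pC′ = ⊆-antisym C′⊆C C⊆C′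
    where
    C⊆C′ : C ⊆ C′
    C⊆C′ {x} x∈C with x ∈? C′
    ... | yes x∈C′ = x∈C′
    ... | no x∉C′ = ⊥-elim (noSmaller C′ (C′⊆C , x , x∈C , x∉C′) pC′)

module _ {n a : ℕ} (A : Hypergraph n a) where

  transversal? : Decidable (Transversal A)
  transversal? S = all? (λ i → nonempty? (S ∩ A i))

  transversal-mono : ∀ {S T} → S ⊆ T → Transversal A S → Transversal A T
  transversal-mono S⊆T tS i =
    let x , x∈S∩Ai = tS i ; x∈S , x∈Ai = x∈p∩q⁻ _ _ x∈S∩Ai
    in x , x∈p∩q⁺ (S⊆T x∈S , x∈Ai)

module _ {n b : ℕ} (B : Hypergraph n b) where

  ∈hit⁺ : ∀ {S i x} → x ∈ S → x ∈ B i → i ∈ hit B S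
  ∈hit⁺ x∈S x∈Bi = ∈⟦⟧⁺ _ (_ , x∈p∩q⁺ (x∈S , x∈Bi))

  ∈hit⁻ : ∀ {S i} → i ∈ hit B S → ∃[ x ] x ∈ S × x ∈ B i
  ∈hit⁻ i∈ = let x , x∈ = ∈⟦⟧⁻ _ i∈ in x , x∈p∩q⁻ _ _ x∈

  hit⊆⇒⊆S[] : ∀ {S C} → hit B S ⊆ C → S ⊆ S[ B ] C
  hit⊆⇒⊆S[] hit⊆C x∈S = ∈⟦⟧⁺ _ λ {_} i∈star → hit⊆C (∈hit⁺ x∈S (∈⟦⟧⁻ _ i∈star))

  ⊆S[]⇒hit⊆ : ∀ {S C} → S ⊆ S[ B ] C → hit B S ⊆ C
  ⊆S[]⇒hit⊆ S⊆ i∈hit =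
    let x , x∈S , x∈Bi = ∈hit⁻ i∈hit in ∈⟦⟧⁻ _ (S⊆ x∈S) (∈⟦⟧⁺ _ x∈Bi)

module _ {n a b : ℕ} (A : Hypergraph n a) (B : Hypergraph n b) where

  f≡1-hit : ∀ {S} → Transversal A S → f≡1 A B (hit B S)
  f≡1-hit = transversal-mono A (hit⊆⇒⊆S[] B ⊆-refl)

lemma1 : ∀ {n a b} (A : Hypergraph n a) (B : Hypergraph n b) →
    IsSimple A → IsSimple B →
    (∀ (S : Subset n) → BiObjMinTransversal A B S → MinimalF A B (hit B S))
    ×
    (∀ (C : Subset b) → MinimalF A B C →
    ∀ (S : Subset n) → MinimalTransversal A S → S ⊆ S[ B ] C →
    BiObjMinTransversal A B S × hit B S ≡ C)
lemma1 A B _ _ = biObjective⇒minimalF , minimalF⇒biObjective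
  where
  biObjective⇒minimalF : ∀ S → BiObjMinTransversal A B S → MinimalF A B (hit B S)
  biObjective⇒minimalF S ((tS , _) , noSmallerHit) = f≡1-hit A B tS , λ C′ C′⊂hitS fC′ →
    let S′ , S′⊆ , minS′ = minimal-⊆ (transversal? A) fC′
    in noSmallerHit S′ minS′ (⊆-⊂-trans (⊆S[]⇒hit⊆ B S′⊆) C′⊂hitS)

  minimalF⇒biObjective : ∀ C → MinimalF A B C → ∀ S → MinimalTransversal A S →
                         S ⊆ S[ B ] C → BiObjMinTransversal A B S × hit B S ≡ C
  minimalF⇒biObjective C minC@(_ , noSmaller) S minS@(tS , _) S⊆ =
    (minS , λ S′ (tS′ , _) hitS′⊂hitS →
      noSmaller (hit B S′) (⊂-⊆-trans hitS′⊂hitS (⊆-reflexive hitS≡C)) (f≡1-hit A B tS′))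
    , hitS≡C
    where
    hitS≡C : hit B S ≡ C
    hitS≡C = minimal-unique minC (⊆S[]⇒hit⊆ B S⊆) (f≡1-hit A B tS)
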